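{- Let $n,k,t$ be positive integers with $t \ge n$ and $k\cdot t = \frac{n(n+1)}{2}$. Then the algorithm $\Pi\mathit{Solve}$ described in the context, run on input $(n;k,t)$, terminates and outputs sets $T_1,\dots,T_k \subseteq \{0,1,\dots,n\}$ such that $T_1\setminus\{0\},\dots,T_k\setminus\{0\}$ are pairwise disjoint, their union is $\{1,\dots,n\}$, and $\sum_{x\in T_j} x = t$ for every $1\le j\le k$.
   Context: For an instance $\Pi(n;k,t)$ (the task of distributing $\{1,\dots,n\}$ into $k$ pairwise disjoint sets, called containers, each with element sum $t$, where $kt=n(n+1)/2$), the recursive algorithm $\Pi\mathit{Solve}$ works as follows. Base cases: if $k=1$, output the single container $\{1,\dots,n\}$; if $k=0$ (which occurs only with $n\le 0$), output nothing. Case $t \le 2n-1$, $t$ even: set $T_i=\{t-n+(i-1),\, n-(i-1)\}$ for $1\le i\le \frac{2n-t}{2}$. Each of the remaining $k-\frac{2n-t}{2}$ containers is split into two subcontainers $T_i=T_{i,1}\cup T_{i,2}$, each of target sum $t/2$; put $T_{\frac{2n-t}{2}+1,1}=\{t/2\}$, and fill the remaining $2(k-n)+t-1$ subcontainers by recursively solving $\Pi(n';k',t')$ with $n'=t-n-1$, $k'=2(k-n)+t-1$, $t'=t/2$ (assigning the resulting sets to these subcontainers in any fixed order). Case $t\le 2n-1$, $t$ odd: set $T_i=\{t-n+(i-1),\, n-(i-1)\}$ for $1\le i\le \frac{2n-t+1}{2}$, and fill the remaining $k-\frac{2n-t+1}{2}$ containers by recursively solving $\Pi(t-n-1;\, k-\frac{2n-t+1}{2},\,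 t)$. Case $t\ge 2n$: split each container as $T_i=T_{i,1}\cup T_{i,2}$ for $1\le i\le k$, set $T_{i,1}=\{n-2k+i,\, n-(i-1)\}$, and fill the containers $T_{i,2}$ by recursively solving $\Pi(n-2k;\, k,\, t-2(n-k)-1)$. -}

module Defs where

open import Data.Nat using (ℕ; zero; suc; _/_)
open import Data.Integer using (ℤ; +_; -[1+_]; _+_; _-_; _*_; ∣_∣; _≤?_; _≟_; 0ℤ; 1ℤ)
open import Data.Integer.DivMod using (_/ℕ_; _%ℕ_)
open import Data.List using (List; []; _∷_; _++_; map; upTo; length)
open import Data.Maybe using (Maybe; just; nothing)
open import Relation.Nullary using (yes; no)

range1 : ℤ → List ℤ
range1 (+ m)    = map (λ j → + suc j) (upTo m)
range1 -[1+ _ ] = []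

count : ℤ → ℕ
count (+ m)    = m
count -[1+ _ ] = 0

pairContainers : ℤ → ℤ → ℕ → List (List ℤ)
pairContainers n t m = map (λ j → (t - n + + j) ∷ (n - + j) ∷ []) (upTo m)

-- join consecutive subcontainers T_{i,1}, T_{i,2} into T_i (fails on odd length)
pairUp : List (List ℤ) → Maybe (List (List ℤ))
pairUp []             = just []
pairUp (_ ∷ [])       = nothing
pairUp (a ∷ b ∷ rest) with pairUp rest
... | nothing = nothing
... | just r  = just ((a ++ b) ∷ r)

-- T_i = T_{i,1} ∪ T_{i,2} componentwise (fails if the numbers differ)
zipUnion : List (List ℤ) → List (List ℤ) → Maybe (List (List ℤ))
zipUnion []       []       = just []
zipUnion (a ∷ as) (b ∷ bs) with zipUnion as bs
... | nothing = nothing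
... | just r  = just ((a ++ b) ∷ r)
zipUnion _        _        = nothing

-- ΠSolve on input (n; k, t), run with a fuel bound on the recursion depth.
-- 'nothing' means the fuel ran out (or the recursive output had a shape
-- that the algorithm cannot assemble).
piSolve : ℕ → ℤ → ℤ → ℤ → Maybe (List (List ℤ))
piSolve zero    n k t = nothing
piSolve (suc f) n k t with k ≟ 1ℤ
... | yes _ = just (range1 n ∷ [])
... | no _ with k ≟ 0ℤ
... | yes _ = just []
... | no _ with t ≤? (+ 2 * n - 1ℤ)
... | no _ =
  go (piSolve f (n - + 2 * k) k (t - + 2 * (n - k) - 1ℤ))
  where
  go : Maybe (List (List ℤ)) → Maybe (List (List ℤ))
  go nothing  = nothing
  go (just R) = zipUnion (map (λ j → (n - + 2 * k + 1ℤ + + j) ∷ (n - + j) ∷ []) (upTo (count k))) R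
... | yes _ with t %ℕ 2
... | zero =
  go (piSolve f (t - n - 1ℤ) (+ 2 * (k - n) + t - 1ℤ) ((t /ℕ 2)))
  where
  go : Maybe (List (List ℤ)) → Maybe (List (List ℤ))
  go nothing  = nothing
  go (just R) with pairUp (((t /ℕ 2) ∷ []) ∷ R)
  ... | nothing = nothing
  ... | just S  = just (pairContainers n t (count (+ 2 * n - t) / 2) ++ S)
... | suc _ =
  go (piSolve f (t - n - 1ℤ) (k - + ((count (+ 2 * n - t + 1ℤ)) / 2)) t)
  where
  go : Maybe (List (List ℤ)) → Maybe (List (List ℤ))
  go nothing  = nothing
  go (just R) = just (pairContainers n t ((count (+ 2 * n - t + 1ℤ)) / 2) ++ R)

sumℤ : List ℤ → ℤ
sumℤ []       = 0ℤ
sumℤ (x ∷ xs) = x + sumℤ xs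

module Submission where

open import Defs

-- Each recursive step of ΠSolve places a
-- batch of two-element containers {a, b} with a + b a fixed value; these use
-- up two blocks of consecutive numbers just below and at the top of {1,…,n},
-- and the rest of the work is a recursive call on a strictly smaller n.


module Arithmetic where

  open import Data.Nat
  open import Data.Nat.Properties
  open import Data.Nat.DivMod using (m≡m%n+[m/n]*n; m%n<n; m*n/n≡m)
  open import Data.Nat.Tactic.RingSolver using (solve-∀)
  open import Data.Product using (∃-syntax; _×_; _,_)
  open import Data.Sum using (_⊎_; inj₁; inj₂)
  open import Data.Empty using (⊥-elim)
  open import Relation.Nullary using (yes; no)
  open import Relation.Binary.PropositionalEquality

  record Admissible (n k t : ℕ) : Set where
    constructor admissible
    field
      t-positive : 1 ≤ t
      n≤t        : n ≤ t
      balanced   : 2 * k * t ≡ n * suc n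

  triangle : ℕ → ℕ
  triangle zero    = 0
  triangle (suc n) = triangle n + suc n

  2*triangle : ∀ n → 2 * triangle n ≡ n * suc n
  2*triangle zero    = refl
  2*triangle (suc n) = begin
    2 * (triangle n + suc n)       ≡⟨ *-distribˡ-+ 2 (triangle n) (suc n) ⟩
    2 * triangle n + 2 * suc n     ≡⟨ cong (_+ 2 * suc n) (2*triangle n) ⟩
    n * suc n + 2 * suc n          ≡⟨ step n ⟩
    suc n * suc (suc n)            ∎
    where
    open ≡-Reasoning
    step : ∀ n → n * suc n + 2 * suc n ≡ suc n * suc (suc n)
    step = solve-∀

  balanced-from-halved : ∀ n k t → k * t ≡ (n * suc n) / 2 → 2 * k * t ≡ n * suc n
  balanced-from-halved n k t kt≡ = begin
    2 * k * t                  ≡⟨ *-assoc 2 k t ⟩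
    2 * (k * t)                ≡⟨ cong (2 *_) kt≡ ⟩
    2 * ((n * suc n) / 2)      ≡⟨ cong (λ x → 2 * (x / 2)) (trans (sym (2*triangle n)) (*-comm 2 (triangle n))) ⟩
    2 * (triangle n * 2 / 2)   ≡⟨ cong (2 *_) (m*n/n≡m (triangle n) 2) ⟩
    2 * triangle n             ≡⟨ 2*triangle n ⟩
    n * suc n                  ∎
    where open ≡-Reasoning

  half-even : ∀ t → t % 2 ≡ 0 → t ≡ t / 2 + t / 2
  half-even t t%2≡0 = trans (m≡m%n+[m/n]*n t 2) (trans (cong (_+ t / 2 * 2) t%2≡0) (*-comm-2 (t / 2)))
    where
    *-comm-2 : ∀ h → 0 + h * 2 ≡ h + h
    *-comm-2 = solve-∀

  half-odd : ∀ t r → t % 2 ≡ suc r → t ≡ suc (t / 2 + t / 2)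
  half-odd t zero    t%2≡1 = trans (m≡m%n+[m/n]*n t 2) (trans (cong (_+ t / 2 * 2) t%2≡1) (*-comm-2 (t / 2)))
    where
    *-comm-2 : ∀ h → 1 + h * 2 ≡ suc (h + h)
    *-comm-2 = solve-∀
  half-odd t (suc r) t%2≡2+r with subst (_< 2) t%2≡2+r (m%n<n t 2)
  ... | s≤s (s≤s ())

  even-or-odd : ∀ t → t % 2 ≡ 0 ⊎ ∃[ r ] t % 2 ≡ suc r
  even-or-odd t with t % 2
  ... | zero  = inj₁ refl
  ... | suc r = inj₂ (r , refl)

  half-double : ∀ m → (m + m) / 2 ≡ m
  half-double m = trans (cong (_/ 2) (+-*-2 m)) (m*n/n≡m m 2)
    where
    +-*-2 : ∀ m → m + m ≡ m * 2
    +-*-2 = solve-∀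

  double≢odd : ∀ a b → a + a ≢ suc (b + b)
  double≢odd zero    b       ()
  double≢odd (suc a) zero    eq with () ← trans (sym (+-suc a a)) (suc-injective eq)
  double≢odd (suc a) (suc b) eq =
    double≢odd a b (suc-injective (trans (sym (+-suc a a)) (trans (suc-injective eq) (cong suc (+-suc b b)))))

  cancel-split : ∀ a b c X → 0 < c → a * c ≡ b * c + X → ∃[ e ] (a ≡ b + e × e * c ≡ X)
  cancel-split a b c X c>0 eq with b ≤? a
  ... | yes b≤a with m≤n⇒∃[o]m+o≡n b≤a
  ...   | e , refl = e , refl , +-cancelˡ-≡ (b * c) _ _ (trans (sym (*-distribʳ-+ c b e)) eq)
  cancel-split a b c X c>0 eq | no b≰a = ⊥-elim (<-irrefl eq (begin-strict
    a * c       <⟨ *-monoˡ-< c {{>-nonZero c>0}} (≰⇒> b≰a) ⟩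
    b * c       ≤⟨ m≤m+n (b * c) X ⟩
    b * c + X   ∎))
    where open ≤-Reasoning

  -- In a wide instance (t ≥ 2n) there is room for the k pairs of the wide
  -- step: 2k·2n ≤ 2kt = n(n+1), so 4k ≤ n + 1.
  wide-room : ∀ {n k t} → 1 ≤ n → Admissible n k t → 2 * n ≤ t → (k + k) + (k + k) ≤ suc n
  wide-room {n} {k} {t} n≥1 (admissible _ _ bal) wide = *-cancelˡ-≤ n {{>-nonZero n≥1}} (begin
    n * ((k + k) + (k + k))  ≡⟨ rearrange n k ⟩
    2 * k * (2 * n)          ≤⟨ *-monoʳ-≤ (2 * k) wide ⟩
    2 * k * t                ≡⟨ bal ⟩
    n * suc n                ∎)
    where
    open ≤-Reasoning
    rearrange : ∀ n k → n * ((k + k) + (k + k)) ≡ 2 * k * (2 * n)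
    rearrange = solve-∀

  -- Wide case (t ≥ 2n): n ≥ 2k, and after the k pairs {n-2k+i, n-(i-1)} have
  -- been placed, the remaining task Π(n-2k; k, t-2n+2k-1) is again admissible.
  wide-params : ∀ {n k t} → 1 ≤ k → Admissible n k t → 2 * n ≤ t →
    ∃[ n′ ] ∃[ t′ ] (n ≡ n′ + (k + k) × t ≡ t′ + suc ((n′ + k) + (n′ + k)) × Admissible n′ k t′)
  wide-params {zero}   {suc k₁} {zero}   _ (admissible () _ _)   _
  wide-params {zero}   {suc k₁} {suc t₁} _ (admissible _ _ ())   _
  wide-params {suc n₀} {suc k₁} {t}      _ adm@(admissible _ _ bal) wide
    with m≤n⇒∃[o]m+o≡n (wide-room (s≤s z≤n) adm wide) | m≤n⇒∃[o]m+o≡n wide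
  ... | w , 4k+w≡1+n | u , 2n+u≡t = n′ , t′ , n-form , t-form , admissible (s≤s z≤n) n′≤t′ bal′
    where
    n k n′ t′ : ℕ
    n  = suc n₀
    k  = suc k₁
    n′ = suc (k₁ + k₁ + w)
    t′ = suc (k₁ + k₁ + u)
    n-form : n ≡ n′ + (k + k)
    n-form = suc-injective (trans (sym 4k+w≡1+n) (regroup k₁ w))
      where
      regroup : ∀ k₁ w → (suc k₁ + suc k₁ + (suc k₁ + suc k₁)) + w ≡ suc (suc (k₁ + k₁ + w) + (suc k₁ + suc k₁))
      regroup = solve-∀
    t-form : t ≡ t′ + suc ((n′ + k) + (n′ + k))
    t-form = trans (sym 2n+u≡t) (trans (cong (λ m → 2 * m + u) n-form) (regroup k₁ w u))
      where
      regroup : ∀ k₁ w u → let k = suc k₁ ; n′ = suc (k₁ + k₁ + w) in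
        2 * (n′ + (k + k)) + u ≡ suc (k₁ + k₁ + u) + suc ((n′ + k) + (n′ + k))
      regroup = solve-∀
    bal′ : 2 * k * t′ ≡ n′ * suc n′
    bal′ = +-cancelʳ-≡ (2 * k * suc ((n′ + k) + (n′ + k))) _ _ (begin
      2 * k * t′ + 2 * k * suc ((n′ + k) + (n′ + k))  ≡⟨ *-distribˡ-+ (2 * k) t′ _ ⟨
      2 * k * (t′ + suc ((n′ + k) + (n′ + k)))        ≡⟨ cong (2 * k *_) t-form ⟨
      2 * k * t                                        ≡⟨ bal ⟩
      n * suc n                                        ≡⟨ cong (λ m → m * suc m) n-form ⟩
      (n′ + (k + k)) * suc (n′ + (k + k))              ≡⟨ expand n′ k ⟩
      n′ * suc n′ + 2 * k * suc ((n′ + k) + (n′ + k))  ∎)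
      where
      open ≡-Reasoning
      expand : ∀ n′ k → (n′ + (k + k)) * suc (n′ + (k + k)) ≡ n′ * suc n′ + 2 * k * suc ((n′ + k) + (n′ + k))
      expand = solve-∀
    -- n′ + 1 ≥ 2k, so 2k·n′ ≤ n′(n′+1) = 2k·t′
    n′≤t′ : n′ ≤ t′
    n′≤t′ = *-cancelˡ-≤ (2 * k) (begin
      2 * k * n′         ≤⟨ m≤m+n (2 * k * n′) (n′ * w) ⟩
      2 * k * n′ + n′ * w ≡⟨ regroup k₁ w ⟨
      n′ * suc n′        ≡⟨ bal′ ⟨
      2 * k * t′         ∎)
      where
      open ≤-Reasoning
      regroup : ∀ k₁ w → let n′ = suc (k₁ + k₁ + w) in n′ * suc n′ ≡ 2 * suc k₁ * n′ + n′ * w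
      regroup = solve-∀

  narrow-half : ∀ {n s} → s + s < 2 * n → s < n
  narrow-half {n} {s} narrow = *-cancelˡ-< 2 s n (subst (_< 2 * n) (double s) narrow)
    where
    double : ∀ s → s + s ≡ 2 * s
    double = solve-∀

  -- Even case (t = 2s ≤ 2n-1): here t > n. With n′ = t-n-1 and q = n-s pairs,
  -- n = n′ + 2q + 1, s = n′ + q + 1, k = q + e + 1, and the task
  -- Π(n′; 2(k-n)+t-1, s) = Π(n′; 2e+1, s) left for the half-containers is admissible.
  even-params : ∀ {n k t s} → Admissible n k t → t ≡ s + s → t < 2 * n →
    ∃[ n′ ] ∃[ q ] ∃[ e ] (n ≡ n′ + suc (q + q) × s ≡ suc (n′ + q) × k ≡ q + suc e × Admissible n′ (suc (e + e)) s)
  even-params {n} {k} {t} {s} (admissible t>0 n≤t bal) refl narrow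
    with m≤n⇒∃[o]m+o≡n {s} {n} (<⇒≤ (narrow-half narrow))
  ... | q , refl with m≤n⇒∃[o]m+o≡n {q} {s} (+-cancelˡ-≤ s q s n≤t)
  ... | zero , refl = ⊥-elim (double≢odd k q (begin
      k + k            ≡⟨ double k ⟩
      2 * k            ≡⟨ *-cancelʳ-≡ (2 * k) (suc (q + q)) t {{>-nonZero t>0}} (trans bal (n≡t q)) ⟩
      suc (q + q)      ∎))
    where
    open ≡-Reasoning
    double : ∀ k → k + k ≡ 2 * k
    double = solve-∀
    n≡t : ∀ q → ((q + 0) + q) * suc ((q + 0) + q) ≡ suc (q + q) * ((q + 0) + (q + 0))
    n≡t = solve-∀
  ... | suc n′ , refl
    with cancel-split k q (2 * t) (t + n′ * suc n′) (≤-trans t>0 (m≤m+n t (t + 0))) (trans (commute k t) (trans bal (split q n′)))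
    where
    commute : ∀ k t → k * (2 * t) ≡ 2 * k * t
    commute = solve-∀
    split : ∀ q n′ → let s = q + suc n′ in (s + q) * suc (s + q) ≡ q * (2 * (s + s)) + ((s + s) + n′ * suc n′)
    split = solve-∀
  ...   | zero , _ , 0≡t+X with () ← <⇒≢ t>0 (sym (m+n≡0⇒m≡0 t (sym 0≡t+X)))
  ...   | suc e , refl , e′·2t≡t+X =
    n′ , q , e , n-form q n′ , s-form q n′ , refl ,
    admissible (≤-trans (s≤s z≤n) (m≤n+m (suc n′) q)) (≤-trans (n≤1+n n′) (m≤n+m (suc n′) q)) bal′
    where
    n-form : ∀ q n′ → (q + suc n′) + q ≡ n′ + suc (q + q)
    n-form = solve-∀
    s-form : ∀ q n′ → q + suc n′ ≡ suc (n′ + q)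
    s-form = solve-∀
    -- (2e+1)·t = t + e·2t = n′(n′+1)
    bal′ : 2 * suc (e + e) * (q + suc n′) ≡ n′ * suc n′
    bal′ = trans (spread e (q + suc n′)) (+-cancelˡ-≡ t _ _ (trans (regroup e t) e′·2t≡t+X))
      where
      spread : ∀ e s → 2 * suc (e + e) * s ≡ (s + s) + e * (2 * (s + s))
      spread = solve-∀
      regroup : ∀ e t → t + (t + e * (2 * t)) ≡ suc e * (2 * t)
      regroup = solve-∀

  -- Odd case (t = 2s+1 ≤ 2n-1), with q = n - s ≥ 1 pairs. Either t = n, where
  -- n = 2q - 1 and k = q, so the pairs alone solve the task; or n′ = t-n-1 ≥ 0,
  -- n = n′ + 2q, t = 2(n′+q)+1, k = q + e, and Π(n′; k-q, t) is admissible.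
  odd-params : ∀ {n k t s} → Admissible n k t → t ≡ suc (s + s) → t < 2 * n →
    ∃[ m ] (n ≡ suc (m + m) × t ≡ suc (m + m) × k ≡ suc m)
    ⊎ ∃[ n′ ] ∃[ m ] ∃[ e ] (n ≡ n′ + (suc m + suc m) × t ≡ suc ((n′ + suc m) + (n′ + suc m))
                             × k ≡ suc m + e × Admissible n′ e t)
  odd-params {n} {k} {t} {s} (admissible t>0 n≤t bal) refl narrow
    with m≤n⇒∃[o]m+o≡n {suc s} {n} (narrow-half (<-trans (n<1+n (s + s)) narrow))
  ... | m , refl with m≤n⇒∃[o]m+o≡n {m} {s} (+-cancelˡ-≤ (suc s) m s n≤t)
  ... | zero , refl = inj₁ (m , n-form m , t-form m , *-cancelˡ-≡ k (suc m) 2 (*-cancelʳ-≡ (2 * k) (2 * suc m) t (trans bal (n≡t m))))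
    where
    n-form : ∀ m → suc (m + 0) + m ≡ suc (m + m)
    n-form = solve-∀
    t-form : ∀ m → suc ((m + 0) + (m + 0)) ≡ suc (m + m)
    t-form = solve-∀
    n≡t : ∀ m → (suc (m + 0) + m) * suc (suc (m + 0) + m) ≡ 2 * suc m * suc ((m + 0) + (m + 0))
    n≡t = solve-∀
  ... | suc n′ , refl with cancel-split k (suc m) (2 * t) (n′ * suc n′) (s≤s z≤n) (trans (commute k t) (trans bal (split m n′)))
    where
    commute : ∀ k t → k * (2 * t) ≡ 2 * k * t
    commute = solve-∀
    split : ∀ m n′ → let s = m + suc n′ in (suc s + m) * suc (suc s + m) ≡ suc m * (2 * suc (s + s)) + n′ * suc n′
    split = solve-∀
  ...   | e , refl , e·2t≡X =
    inj₂ (n′ , m , e , n-form m n′ , t-form m n′ , refl ,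
          admissible t>0 (≤-trans (m≤m+n n′ _) (subst (_≤ t) (n-form m n′) n≤t)) (trans (commute e t) e·2t≡X))
    where
    n-form : ∀ m n′ → suc (m + suc n′) + m ≡ n′ + (suc m + suc m)
    n-form = solve-∀
    t-form : ∀ m n′ → suc ((m + suc n′) + (m + suc n′)) ≡ suc ((n′ + suc m) + (n′ + suc m))
    t-form = solve-∀
    commute : ∀ e t → 2 * e * t ≡ e * (2 * t)
    commute = solve-∀

module Containers where

  open Arithmetic using (triangle)

  open import Data.Nat as ℕ using (ℕ; zero; suc; z≤n)
  open import Data.Integer using (ℤ; +_; _+_; _-_; 0ℤ; 1ℤ; _≤_; _≟_; +≤+)
  import Data.Integer.Properties as ℤP
  import Data.Nat.Properties as ℕP
  open import Data.Integer.Tactic.RingSolver using (solve-∀)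
  open import Data.List using (List; []; _∷_; _++_; [_]; map; applyUpTo; upTo; length; concat; concatMap; filter)
  import Data.List.Properties as LP
  open import Data.List.Relation.Unary.All as All using (All; []; _∷_)
  import Data.List.Relation.Unary.All.Properties as AllP
  open import Data.List.Relation.Unary.Unique.Propositional using (Unique)
  open import Data.List.Relation.Unary.AllPairs using ([]; _∷_)
  import Data.List.Relation.Unary.Unique.Propositional.Properties as UniqueP
  open import Data.List.Relation.Binary.Permutation.Propositional
    using (_↭_; ↭-refl; ↭-sym; ↭-trans; ↭-reflexive; prep; ↭⇒↭ₛ; module PermutationReasoning)
  import Data.List.Relation.Binary.Permutation.Propositional.Properties as PermP
  import Data.List.Relation.Binary.Permutation.Setoid.Properties as PermSetoidP
  open import Data.Maybe using (just)
  open import Data.Product using (∃-syntax; _×_; _,_)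
  open import Data.Sum using (_⊎_; inj₁; inj₂)
  open import Relation.Nullary using (¬_; Dec)
  open import Relation.Nullary.Decidable using (¬?)
  open import Relation.Binary.PropositionalEquality hiding ([_])

  interval : ℤ → ℕ → List ℤ
  interval a zero    = []
  interval a (suc m) = a ∷ interval (a + 1ℤ) m

  private
    shift-start : ∀ a b → a + (1ℤ + b) ≡ a + 1ℤ + b
    shift-start = solve-∀

  interval-++ : ∀ a b m p → b ≡ a + + m → interval a m ++ interval b p ≡ interval a (m ℕ.+ p)
  interval-++ a b zero    p b≡a = cong (λ c → interval c p) (trans b≡a (ℤP.+-identityʳ a))
  interval-++ a b (suc m) p b≡a =
    cong (a ∷_) (interval-++ (a + 1ℤ) b m p (trans b≡a (shift-start a (+ m))))

  interval-∷ʳ : ∀ a m → interval a m ++ [ a + + m ] ≡ interval a (suc m)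
  interval-∷ʳ a m = trans (interval-++ a (a + + m) m 1 refl) (cong (interval a) (ℕP.+-comm m 1))

  range1≡interval : ∀ n → range1 (+ n) ≡ interval 1ℤ n
  range1≡interval n = trans (LP.map-upTo (λ j → + suc j) n) (applyUpTo-interval 1ℤ n refl)
    where
    applyUpTo-interval : ∀ a m {f : ℕ → ℤ} → (∀ {j} → f j ≡ a + + j) → applyUpTo f m ≡ interval a m
    applyUpTo-interval a zero    f≗ = refl
    applyUpTo-interval a (suc m) f≗ =
      cong₂ _∷_ (trans f≗ (ℤP.+-identityʳ a)) (applyUpTo-interval (a + 1ℤ) m (trans f≗ (shift-start a _)))

  consecutive-blocks : ∀ a b c →
    interval 1ℤ a ++ (interval (+ suc a) b ++ interval (+ suc (a ℕ.+ b)) c) ≡ interval 1ℤ (a ℕ.+ (b ℕ.+ c))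
  consecutive-blocks a b c =
    trans (cong (interval 1ℤ a ++_) (interval-++ (+ suc a) (+ suc (a ℕ.+ b)) b c refl)) (interval-++ 1ℤ (+ suc a) a (b ℕ.+ c) refl)

  sumℤ-++ : ∀ xs ys → sumℤ (xs ++ ys) ≡ sumℤ xs + sumℤ ys
  sumℤ-++ []       ys = sym (ℤP.+-identityˡ (sumℤ ys))
  sumℤ-++ (x ∷ xs) ys = trans (cong (λ s → x + s) (sumℤ-++ xs ys)) (sym (ℤP.+-assoc x (sumℤ xs) (sumℤ ys)))

  sum-range1 : ∀ n → sumℤ (range1 (+ n)) ≡ + triangle n
  sum-range1 n = trans (cong sumℤ (range1≡interval n)) (sum-interval n)
    where
    sum-interval : ∀ n → sumℤ (interval 1ℤ n) ≡ + triangle n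
    sum-interval zero    = refl
    sum-interval (suc n) = begin
      sumℤ (interval 1ℤ (suc n))                 ≡⟨ cong sumℤ (interval-∷ʳ 1ℤ n) ⟨
      sumℤ (interval 1ℤ n ++ [ + suc n ])        ≡⟨ sumℤ-++ (interval 1ℤ n) [ + suc n ] ⟩
      sumℤ (interval 1ℤ n) + (+ suc n + 0ℤ)      ≡⟨ cong₂ _+_ (sum-interval n) (ℤP.+-identityʳ (+ suc n)) ⟩
      + triangle (suc n)                         ∎
      where open ≡-Reasoning

  AllSum : ℤ → List (List ℤ) → Set
  AllSum a = All (λ T → sumℤ T ≡ a)

  IsPairFamily : ℤ → ℤ → (ℕ → List ℤ) → Set
  IsPairFamily A B f = ∀ j → f j ≡ (A + + j) ∷ (B - + j) ∷ []

  length-pairs : ∀ (f : ℕ → List ℤ) m → length (map f (upTo m)) ≡ m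
  length-pairs f m = trans (LP.length-map f (upTo m)) (LP.length-upTo m)

  pairs-sum : ∀ A B {f} m → IsPairFamily A B f → AllSum (A + B) (map f (upTo m))
  pairs-sum A B {f} m pair =
    subst (AllSum (A + B)) (sym (LP.map-upTo f m)) (AllP.applyUpTo⁺₂ f m (λ j → trans (cong sumℤ (pair j)) (pair-sum A B (+ j))))
    where
    pair-sum : ∀ A B j → A + j + (B - j + 0ℤ) ≡ A + B
    pair-sum = solve-∀

  private
    concat-applyUpTo-pairs↭ : ∀ {A B f} m C → IsPairFamily A B f → C + + m ≡ B + 1ℤ →
                              concat (applyUpTo f m) ↭ interval A m ++ interval C m
    concat-applyUpTo-pairs↭ zero    C pair top = ↭-refl
    concat-applyUpTo-pairs↭ {A} {B} {f} (suc m) C pair top = begin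
        f 0 ++ concat (applyUpTo (λ j → f (suc j)) m)
      ≡⟨ cong (_++ concat (applyUpTo (λ j → f (suc j)) m))
              (trans (pair 0) (cong₂ (λ a b → a ∷ b ∷ []) (ℤP.+-identityʳ A) (ℤP.+-identityʳ B))) ⟩
        A ∷ B ∷ concat (applyUpTo (λ j → f (suc j)) m)
      ↭⟨ prep A (prep B (concat-applyUpTo-pairs↭ {B = B - 1ℤ} m C inner (trans top′ (sym sub-add)))) ⟩
        A ∷ B ∷ (interval (A + 1ℤ) m ++ interval C m)
      ↭⟨ prep A (PermP.∷↭∷ʳ B _) ⟩
        A ∷ ((interval (A + 1ℤ) m ++ interval C m) ++ [ B ])
      ≡⟨ cong (A ∷_) (LP.++-assoc (interval (A + 1ℤ) m) (interval C m) [ B ]) ⟩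
        A ∷ (interval (A + 1ℤ) m ++ (interval C m ++ [ B ]))
      ≡⟨ cong (λ b → A ∷ (interval (A + 1ℤ) m ++ (interval C m ++ [ b ]))) (sym top′) ⟩
        A ∷ (interval (A + 1ℤ) m ++ (interval C m ++ [ C + + m ]))
      ≡⟨ cong (λ I → A ∷ (interval (A + 1ℤ) m ++ I)) (interval-∷ʳ C m) ⟩
        interval A (suc m) ++ interval C (suc m)
      ∎
      where
      open PermutationReasoning
      inner : IsPairFamily (A + 1ℤ) (B - 1ℤ) (λ j → f (suc j))
      inner j = trans (pair (suc j)) (cong₂ (λ a b → a ∷ b ∷ []) (shift-start A (+ j)) (step-down B (+ j)))
        where
        step-down : ∀ B j → B - (1ℤ + j) ≡ B - 1ℤ - j
        step-down = solve-∀
      -- the remaining m pairs have high block [C, B - 1], so C + m = B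
      top′ : C + + m ≡ B
      top′ = trans (drop-one C (+ m)) (trans (cong (_- 1ℤ) top) (add-sub B))
        where
        drop-one : ∀ C m → C + m ≡ C + (1ℤ + m) - 1ℤ
        drop-one = solve-∀
        add-sub : ∀ B → B + 1ℤ - 1ℤ ≡ B
        add-sub = solve-∀
      sub-add : B - 1ℤ + 1ℤ ≡ B
      sub-add = identity B
        where
        identity : ∀ B → B - 1ℤ + 1ℤ ≡ B
        identity = solve-∀

  concat-pairs↭ : ∀ A B {f} m C → IsPairFamily A B f → C + + m ≡ B + 1ℤ →
                  concat (map f (upTo m)) ↭ interval A m ++ interval C m
  concat-pairs↭ A B {f} m C pair top =
    subst (λ L → concat L ↭ _) (sym (LP.map-upTo f m)) (concat-applyUpTo-pairs↭ {A} {B} m C pair top)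

  pairContainers-length : ∀ N T q → length (pairContainers N T q) ≡ q
  pairContainers-length N T q = length-pairs (λ j → (T - N + + j) ∷ (N - + j) ∷ []) q

  pairContainers-sum : ∀ N T q → AllSum T (pairContainers N T q)
  pairContainers-sum N T q = subst (λ a → AllSum a (pairContainers N T q)) (cancel T N) (pairs-sum (T - N) N q (λ j → refl))
    where
    cancel : ∀ T N → T - N + N ≡ T
    cancel = solve-∀

  pairContainers-concat : ∀ N T A C q → T - N ≡ A → C + + q ≡ N + 1ℤ →
                          concat (pairContainers N T q) ↭ interval A q ++ interval C q
  pairContainers-concat N T A C q low top = concat-pairs↭ A N q C (λ j → cong (λ a → (a + + j) ∷ (N - + j) ∷ []) low) top

  insert-↭ : ∀ (I J W : List ℤ) x → (I ++ J) ++ (x ∷ W) ↭ (I ++ x ∷ J) ++ W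
  insert-↭ I J W x = begin
    (I ++ J) ++ (x ∷ W)  ≡⟨ LP.++-assoc I J (x ∷ W) ⟩
    I ++ (J ++ [ x ] ++ W) ↭⟨ PermP.++⁺ˡ I (PermP.shift x J W) ⟩
    I ++ (x ∷ J ++ W)    ≡⟨ LP.++-assoc I (x ∷ J) W ⟨
    (I ++ x ∷ J) ++ W    ∎
    where open PermutationReasoning

  zipUnion-spec : ∀ (A R : List (List ℤ)) → length A ≡ length R →
    ∃[ Ts ] (zipUnion A R ≡ just Ts × length Ts ≡ length A × concat Ts ↭ concat A ++ concat R
             × (∀ {a b} → AllSum a A → AllSum b R → AllSum (a + b) Ts))
  zipUnion-spec []      []      _  = [] , refl , refl , ↭-refl , λ _ _ → []
  zipUnion-spec (T ∷ A) (U ∷ R) eq with zipUnion-spec A R (ℕP.suc-injective eq)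
  ... | Ts , zipped , size , perm , sums rewrite zipped =
    (T ++ U) ∷ Ts , refl , cong suc size , perm′ , λ { (sT ∷ sA) (sU ∷ sR) → trans (sumℤ-++ T U) (cong₂ _+_ sT sU) ∷ sums sA sR }
    where
    open PermutationReasoning
    perm′ : (T ++ U) ++ concat Ts ↭ (T ++ concat A) ++ (U ++ concat R)
    perm′ = begin
      (T ++ U) ++ concat Ts             ≡⟨ LP.++-assoc T U (concat Ts) ⟩
      T ++ (U ++ concat Ts)             ↭⟨ PermP.++⁺ˡ T (PermP.++⁺ˡ U perm) ⟩
      T ++ (U ++ (concat A ++ concat R)) ↭⟨ PermP.++⁺ˡ T (PermP.shifts U (concat A)) ⟩
      T ++ (concat A ++ (U ++ concat R)) ≡⟨ LP.++-assoc T (concat A) (U ++ concat R) ⟨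
      (T ++ concat A) ++ (U ++ concat R) ∎

  pairUp-spec : ∀ q (L : List (List ℤ)) → length L ≡ q ℕ.+ q →
    ∃[ S ] (pairUp L ≡ just S × length S ≡ q × concat S ≡ concat L × (∀ {a} → AllSum a L → AllSum (a + a) S))
  pairUp-spec zero    []          _  = [] , refl , refl , refl , λ _ → []
  pairUp-spec (suc q) (T ∷ [])    eq with () ← ℕP.suc-injective (trans eq (ℕP.+-suc (suc q) q))
  pairUp-spec (suc q) (T ∷ U ∷ L) eq
    with pairUp-spec q L (ℕP.suc-injective (ℕP.suc-injective (trans eq (cong suc (ℕP.+-suc q q)))))
  ... | S , paired , size , elems , sums rewrite paired =
    (T ++ U) ∷ S , refl , cong suc size , trans (LP.++-assoc T U (concat S)) (cong (λ X → T ++ (U ++ X)) elems) ,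
    λ { (sT ∷ sU ∷ sL) → trans (sumℤ-++ T U) (cong₂ _+_ sT sU) ∷ sums sL }

  -- X lists each of 1, …, n exactly once, possibly together with a single 0
  -- (the pair {0, n} occurs when an odd target equals n).
  Covers : ℕ → List ℤ → Set
  Covers n X = X ↭ interval 1ℤ n ⊎ X ↭ 0ℤ ∷ interval 1ℤ n

  covers-glue : ∀ {n′ n X Y} P → Covers n′ Y → X ↭ P ++ Y → interval 1ℤ n′ ++ P ≡ interval 1ℤ n → Covers n X
  covers-glue {n′} P (inj₁ Y↭) X↭ blocks =
    inj₁ (↭-trans X↭ (↭-trans (PermP.++⁺ˡ P Y↭) (↭-trans (PermP.++-comm P (interval 1ℤ n′)) (↭-reflexive blocks))))
  covers-glue {n′} P (inj₂ Y↭) X↭ blocks =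
    inj₂ (↭-trans X↭ (↭-trans (PermP.++⁺ˡ P Y↭)
                     (↭-trans (PermP.++-comm P (0ℤ ∷ interval 1ℤ n′)) (↭-reflexive (cong (0ℤ ∷_) blocks)))))

  record IsSolution (n k t : ℕ) (Ts : List (List ℤ)) : Set where
    constructor solution
    field
      size   : length Ts ≡ k
      sums   : AllSum (+ t) Ts
      covers : Covers n (concat Ts)

  InRange : ℕ → ℤ → Set
  InRange n x = 0ℤ ≤ x × x ≤ + n

  NonZero? : (x : ℤ) → Dec (¬ x ≡ 0ℤ)
  NonZero? x = ¬? (x ≟ 0ℤ)

  Exact : ℕ → List ℤ → Set
  Exact n X = All (InRange n) X × Unique X × filter NonZero? X ↭ range1 (+ n)

  Exact-resp-↭ : ∀ {n X Y} → X ↭ Y → Exact n Y → Exact n X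
  Exact-resp-↭ X↭Y (inY , uniqueY , filterY) =
    PermP.All-resp-↭ (↭-sym X↭Y) inY ,
    PermSetoidP.Unique-resp-↭ (setoid ℤ) (↭⇒↭ₛ (↭-sym X↭Y)) uniqueY ,
    ↭-trans (PermP.filter-↭ NonZero? X↭Y) filterY

  range1-applyUpTo : ∀ n → range1 (+ n) ≡ applyUpTo (λ j → + suc j) n
  range1-applyUpTo n = LP.map-upTo (λ j → + suc j) n

  range1-nonzero : ∀ n → All (λ x → ¬ x ≡ 0ℤ) (range1 (+ n))
  range1-nonzero n = subst (All (λ x → ¬ x ≡ 0ℤ)) (sym (range1-applyUpTo n)) (AllP.applyUpTo⁺₂ _ n (λ j ()))

  range1-exact : ∀ n → Exact n (range1 (+ n))
  range1-exact n =
    subst (All (InRange n)) (sym (range1-applyUpTo n)) (AllP.applyUpTo⁺₁ _ n (λ j<n → +≤+ z≤n , +≤+ j<n)) ,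
    subst Unique (sym (range1-applyUpTo n))
      (UniqueP.applyUpTo⁺₁ _ n (λ i<j _ eq → ℕP.<⇒≢ i<j (ℕP.suc-injective (ℤP.+-injective eq)))) ,
    ↭-reflexive (LP.filter-all NonZero? (range1-nonzero n))

  0∷range1-exact : ∀ n → Exact n (0ℤ ∷ range1 (+ n))
  0∷range1-exact n with range1-exact n
  ... | inR , uniqueR , filterR =
    (ℤP.≤-refl , +≤+ z≤n) ∷ inR , All.map (λ x≢0 0≡x → x≢0 (sym 0≡x)) (range1-nonzero n) ∷ uniqueR , filterR

  covers⇒exact : ∀ {n X} → Covers n X → Exact n X
  covers⇒exact {n} (inj₁ X↭) = Exact-resp-↭ (↭-trans X↭ (↭-reflexive (sym (range1≡interval n)))) (range1-exact n)
  covers⇒exact {n} (inj₂ X↭) =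
    Exact-resp-↭ (↭-trans X↭ (↭-reflexive (cong (0ℤ ∷_) (sym (range1≡interval n))))) (0∷range1-exact n)

  unique-concat⁻ : ∀ (Ts : List (List ℤ)) → Unique (concat Ts) → All Unique Ts
  unique-concat⁻ []       _      = []
  unique-concat⁻ (T ∷ Ts) unique = unique-++ˡ T unique ∷ unique-concat⁻ Ts (unique-++ʳ T unique)
    where
    unique-++ˡ : ∀ xs {ys : List ℤ} → Unique (xs ++ ys) → Unique xs
    unique-++ˡ []       _          = []
    unique-++ˡ (x ∷ xs) (x∉ ∷ u)  = AllP.++⁻ˡ xs x∉ ∷ unique-++ˡ xs u
    unique-++ʳ : ∀ xs {ys : List ℤ} → Unique (xs ++ ys) → Unique ys
    unique-++ʳ []       u          = u
    unique-++ʳ (x ∷ xs) (_ ∷ u)    = unique-++ʳ xs u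

  filter-concat : ∀ (Ts : List (List ℤ)) → concatMap (filter NonZero?) Ts ≡ filter NonZero? (concat Ts)
  filter-concat []       = refl
  filter-concat (T ∷ Ts) = trans (cong (filter NonZero? T ++_) (filter-concat Ts)) (sym (LP.filter-++ NonZero? T (concat Ts)))

  solution-spec : ∀ {n k t Ts} → IsSolution n k t Ts →
    length Ts ≡ k × All (λ T → All (InRange n) T × Unique T × sumℤ T ≡ + t) Ts
    × concatMap (filter NonZero?) Ts ↭ range1 (+ n)
  solution-spec {n} {Ts = Ts} (solution size sums covers) with covers⇒exact covers
  ... | inRange , unique , filtered =
    size ,
    All.zipWith (λ { ((inT , uniqueT) , sumT) → inT , uniqueT , sumT })
      (All.zipWith (λ p → p) (AllP.concat⁻ inRange , unique-concat⁻ Ts unique) , sums) ,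
    subst (_↭ range1 (+ n)) (sym (filter-concat Ts)) filtered

module Unfolding where

  open import Data.Nat as ℕ using (suc; _/_)
  open import Data.Integer using (ℤ; +_; _+_; _-_; _*_; 0ℤ; 1ℤ; _≤_; _≤?_; _≟_; +≤+)
  import Data.Integer.Properties as ℤP
  import Data.Nat.Properties as ℕP
  open import Data.Integer.DivMod using (_/ℕ_; _%ℕ_)
  open import Data.List using ([]; _∷_; _++_; map; upTo)
  open import Data.Maybe using (just)
  open import Data.Empty using (⊥-elim)
  open import Relation.Nullary using (¬_; yes; no)
  open import Data.Product using (_×_; _,_)
  open import Relation.Binary.PropositionalEquality

  NotBase : ℤ → Set
  NotBase K = ¬ K ≡ 1ℤ × ¬ K ≡ 0ℤ

  narrow⇒< : ∀ {t n₀} → + t ≤ + 2 * + suc n₀ - 1ℤ → t ℕ.< 2 ℕ.* suc n₀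
  narrow⇒< narrow = ℕ.s≤s (ℤP.drop‿+≤+ narrow)

  wide⇒≥ : ∀ {t n₀} → ¬ (+ t ≤ + 2 * + suc n₀ - 1ℤ) → 2 ℕ.* suc n₀ ℕ.≤ t
  wide⇒≥ wide = ℕP.≰⇒> (λ t≤2n-1 → wide (+≤+ t≤2n-1))

  piSolve-wide : ∀ {f N K T N′ T′ R} → NotBase K → ¬ T ≤ + 2 * N - 1ℤ →
    N - + 2 * K ≡ N′ → T - + 2 * (N - K) - 1ℤ ≡ T′ → piSolve f N′ K T′ ≡ just R →
    piSolve (suc f) N K T ≡ zipUnion (map (λ j → (N - + 2 * K + 1ℤ + + j) ∷ (N - + j) ∷ []) (upTo (count K))) R
  piSolve-wide {f} {N} {K} {T} (K≢1 , K≢0) wide refl refl rec with K ≟ 1ℤ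
  ... | yes K≡1 = ⊥-elim (K≢1 K≡1)
  ... | no _ with K ≟ 0ℤ
  ... | yes K≡0 = ⊥-elim (K≢0 K≡0)
  ... | no _ with T ≤? (+ 2 * N - 1ℤ)
  ... | yes narrow = ⊥-elim (wide narrow)
  ... | no _ rewrite rec = refl

  piSolve-even : ∀ {f N K T q N′ K′ H R S} → NotBase K → T ≤ + 2 * N - 1ℤ → T %ℕ 2 ≡ 0 →
    count (+ 2 * N - T) / 2 ≡ q → T - N - 1ℤ ≡ N′ → + 2 * (K - N) + T - 1ℤ ≡ K′ → T /ℕ 2 ≡ H →
    piSolve f N′ K′ H ≡ just R → pairUp ((H ∷ []) ∷ R) ≡ just S →
    piSolve (suc f) N K T ≡ just (pairContainers N T q ++ S)
  piSolve-even {f} {N} {K} {T} (K≢1 , K≢0) narrow even refl refl refl refl rec paired with K ≟ 1ℤ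
  ... | yes K≡1 = ⊥-elim (K≢1 K≡1)
  ... | no _ with K ≟ 0ℤ
  ... | yes K≡0 = ⊥-elim (K≢0 K≡0)
  ... | no _ with T ≤? (+ 2 * N - 1ℤ)
  ... | no wide = ⊥-elim (wide narrow)
  ... | yes _ rewrite even | rec | paired = refl

  piSolve-odd : ∀ {f N K T q N′ K′ R r} → NotBase K → T ≤ + 2 * N - 1ℤ → T %ℕ 2 ≡ suc r →
    count (+ 2 * N - T + 1ℤ) / 2 ≡ q → T - N - 1ℤ ≡ N′ → K - + q ≡ K′ → piSolve f N′ K′ T ≡ just R →
    piSolve (suc f) N K T ≡ just (pairContainers N T q ++ R)
  piSolve-odd {f} {N} {K} {T} (K≢1 , K≢0) narrow odd refl refl refl rec with K ≟ 1ℤ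
  ... | yes K≡1 = ⊥-elim (K≢1 K≡1)
  ... | no _ with K ≟ 0ℤ
  ... | yes K≡0 = ⊥-elim (K≢0 K≡0)
  ... | no _ with T ≤? (+ 2 * N - 1ℤ)
  ... | no wide = ⊥-elim (wide narrow)
  ... | yes _ rewrite odd | rec = refl

module Correctness where

  open Arithmetic
  open Containers
  open Unfolding

  open import Data.Nat as ℕ using (ℕ; zero; suc; z≤n; s≤s; _%_)
  import Data.Nat.Properties as ℕP
  open import Data.Integer using (ℤ; +_; _+_; _-_; _*_; 0ℤ; 1ℤ; -1ℤ; _≤_; _≤?_)
  import Data.Integer.Properties as ℤP
  open import Data.Integer.Tactic.RingSolver using (solve-∀)
  open import Data.List using (List; []; _∷_; _++_; [_]; map; upTo; concat)
  import Data.List.Properties as LP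
  open import Data.List.Relation.Unary.All using ([]; _∷_)
  import Data.List.Relation.Unary.All.Properties as AllP
  open import Data.List.Relation.Binary.Permutation.Propositional using (_↭_; ↭-refl; ↭-trans; ↭-reflexive; module PermutationReasoning)
  import Data.List.Relation.Binary.Permutation.Propositional.Properties as PermP
  open import Data.Maybe using (just)
  open import Data.Product using (∃-syntax; _×_; _,_)
  open import Data.Sum using (inj₁; inj₂)
  open import Function using (case_of_)
  open import Relation.Nullary using (¬_; yes; no)
  open import Relation.Binary.PropositionalEquality hiding ([_])

  Solvable : ℕ → ℕ → ℕ → ℕ → Set
  Solvable f n k t = ∃[ Ts ] (piSolve f (+ n) (+ k) (+ t) ≡ just Ts × IsSolution n k t Ts)

  no-base-case : ∀ {k} → 2 ℕ.≤ k → NotBase (+ k)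
  no-base-case (s≤s (s≤s _)) = (λ ()) , (λ ())

  wide-pair : ℕ → ℕ → ℕ → List ℤ
  wide-pair n k j = (+ n - + 2 * + k + 1ℤ + + j) ∷ (+ n - + j) ∷ []

  wide-case : ∀ {f n k t n′ t′} → 2 ℕ.≤ k → ¬ (+ t ≤ + 2 * + n - 1ℤ) →
    n ≡ n′ ℕ.+ (k ℕ.+ k) → t ≡ t′ ℕ.+ suc ((n′ ℕ.+ k) ℕ.+ (n′ ℕ.+ k)) →
    Solvable f n′ k t′ → Solvable (suc f) n k t
  wide-case {n = n} {k = k} {n′ = n′} {t′ = t′} k≥2 wide refl refl (R , rec , solution sizeR sumsR coversR)
    with zipUnion-spec (map (wide-pair n k) (upTo k)) R (trans (length-pairs (wide-pair n k) k) (sym sizeR))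
  ... | Ts , zipped , size , perm , sums =
    Ts , trans (piSolve-wide (no-base-case k≥2) wide (recursive-n (+ n′) (+ k)) (recursive-t (+ n′) (+ k) (+ t′)) rec) zipped ,
    solution (trans size (length-pairs (wide-pair n k) k))
             (subst (λ a → AllSum a Ts) (total-sum (+ n′) (+ k) (+ t′)) (sums (pairs-sum (+ suc n′) (+ n) k is-pair) sumsR))
             (covers-glue _ coversR (↭-trans perm (PermP.++⁺ʳ (concat R) pairs-used)) (consecutive-blocks n′ k k))
    where
    recursive-n : ∀ n′ k → n′ + (k + k) - + 2 * k ≡ n′
    recursive-n = solve-∀
    recursive-t : ∀ n′ k t′ → t′ + (1ℤ + ((n′ + k) + (n′ + k))) - + 2 * (n′ + (k + k) - k) - 1ℤ ≡ t′
    recursive-t = solve-∀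
    total-sum : ∀ n′ k t′ → (1ℤ + n′) + (n′ + (k + k)) + t′ ≡ t′ + (1ℤ + ((n′ + k) + (n′ + k)))
    total-sum = solve-∀
    high-start : ∀ n′ k → (1ℤ + (n′ + k)) + k ≡ n′ + (k + k) + 1ℤ
    high-start = solve-∀
    is-pair : IsPairFamily (+ suc n′) (+ n) (wide-pair n k)
    is-pair j = cong (λ a → (a + + j) ∷ (+ n - + j) ∷ []) (low-start (+ n′) (+ k))
      where
      low-start : ∀ n′ k → n′ + (k + k) - + 2 * k + 1ℤ ≡ 1ℤ + n′
      low-start = solve-∀
    pairs-used : concat (map (wide-pair n k) (upTo k)) ↭ interval (+ suc n′) k ++ interval (+ suc (n′ ℕ.+ k)) k
    pairs-used = concat-pairs↭ (+ suc n′) (+ n) k (+ suc (n′ ℕ.+ k)) is-pair (high-start (+ n′) (+ k))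

  even-case : ∀ {f n k t s n′ q e} → 2 ℕ.≤ k → + t ≤ + 2 * + n - 1ℤ → t % 2 ≡ 0 → t ≡ s ℕ.+ s →
    n ≡ n′ ℕ.+ suc (q ℕ.+ q) → s ≡ suc (n′ ℕ.+ q) → k ≡ q ℕ.+ suc e →
    Solvable f n′ (suc (e ℕ.+ e)) s → Solvable (suc f) n k t
  even-case {n = n} {t = t} {s = s} {n′ = n′} {q = q} {e = e} k≥2 narrow even refl refl refl refl (R , rec , solution sizeR sumsR coversR)
    with pairUp-spec (suc e) ([ + s ] ∷ R) (cong suc (trans sizeR (sym (ℕP.+-suc e e))))
  ... | S , paired , sizeS , elemsS , sumsS =
    P ++ S ,
    piSolve-even (no-base-case k≥2) narrow even pair-count (recursive-n (+ n′) (+ q)) (recursive-k (+ n′) (+ q) (+ e))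
                 (cong +_ (half-double s)) rec paired ,
    solution (trans (LP.length-++ P) (cong₂ ℕ._+_ (pairContainers-length (+ n) (+ t) q) sizeS))
             (AllP.++⁺ (pairContainers-sum (+ n) (+ t) q) (sumsS (ℤP.+-identityʳ (+ s) ∷ sumsR)))
             (covers-glue (interval (+ suc n′) q ++ interval (+ s) (suc q)) coversR perm
                          (trans (consecutive-blocks n′ q (suc q)) (cong (λ m → interval 1ℤ (n′ ℕ.+ m)) (ℕP.+-suc q q))))
    where
    P : List (List ℤ)
    P = pairContainers (+ n) (+ t) q
    pair-count : count (+ 2 * + n - + t) ℕ./ 2 ≡ q
    pair-count = trans (cong (λ z → count z ℕ./ 2) (difference (+ n′) (+ q))) (half-double q)
      where
      difference : ∀ n′ q → + 2 * (n′ + (1ℤ + (q + q))) - ((1ℤ + (n′ + q)) + (1ℤ + (n′ + q))) ≡ q + q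
      difference = solve-∀
    recursive-n : ∀ n′ q → (1ℤ + (n′ + q)) + (1ℤ + (n′ + q)) - (n′ + (1ℤ + (q + q))) - 1ℤ ≡ n′
    recursive-n = solve-∀
    recursive-k : ∀ n′ q e → + 2 * ((q + (1ℤ + e)) - (n′ + (1ℤ + (q + q)))) + ((1ℤ + (n′ + q)) + (1ℤ + (n′ + q))) - 1ℤ ≡ 1ℤ + (e + e)
    recursive-k = solve-∀
    -- the pairs use [n′+1, n′+q] and [s+1, s+q]; the halves contribute s
    perm : concat (P ++ S) ↭ (interval (+ suc n′) q ++ interval (+ s) (suc q)) ++ concat R
    perm = begin
      concat (P ++ S)                                              ≡⟨ LP.concat-++ P S ⟨
      concat P ++ concat S                                         ≡⟨ cong (concat P ++_) elemsS ⟩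
      concat P ++ (+ s ∷ concat R)                                 ↭⟨ PermP.++⁺ʳ _ pairs-used ⟩
      (interval (+ suc n′) q ++ interval (+ s + 1ℤ) q) ++ (+ s ∷ concat R) ↭⟨ insert-↭ _ _ (concat R) (+ s) ⟩
      (interval (+ suc n′) q ++ interval (+ s) (suc q)) ++ concat R ∎
      where
      open PermutationReasoning
      low-start : ∀ n′ q → (1ℤ + (n′ + q)) + (1ℤ + (n′ + q)) - (n′ + (1ℤ + (q + q))) ≡ 1ℤ + n′
      low-start = solve-∀
      high-start : ∀ n′ q → (1ℤ + (n′ + q)) + 1ℤ + q ≡ n′ + (1ℤ + (q + q)) + 1ℤ
      high-start = solve-∀
      pairs-used : concat P ↭ interval (+ suc n′) q ++ interval (+ s + 1ℤ) q
      pairs-used = pairContainers-concat (+ n) (+ t) (+ suc n′) (+ s + 1ℤ) q (low-start (+ n′) (+ q)) (high-start (+ n′) (+ q))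

  odd-case : ∀ {f n k t r n′ m e} → 2 ℕ.≤ k → + t ≤ + 2 * + n - 1ℤ → t % 2 ≡ suc r →
    n ≡ n′ ℕ.+ (suc m ℕ.+ suc m) → t ≡ suc ((n′ ℕ.+ suc m) ℕ.+ (n′ ℕ.+ suc m)) → k ≡ suc m ℕ.+ e →
    Solvable f n′ e t → Solvable (suc f) n k t
  odd-case {n = n} {t = t} {n′ = n′} {m = m} {e = e} k≥2 narrow odd refl refl refl (R , rec , solution sizeR sumsR coversR) =
    P ++ R ,
    piSolve-odd (no-base-case k≥2) narrow odd pair-count (recursive-n (+ n′) (+ m)) (recursive-k (+ m) (+ e)) rec ,
    solution (trans (LP.length-++ P) (cong₂ ℕ._+_ (pairContainers-length (+ n) (+ t) (suc m)) sizeR))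
             (AllP.++⁺ (pairContainers-sum (+ n) (+ t) (suc m)) sumsR)
             (covers-glue _ coversR perm (consecutive-blocks n′ (suc m) (suc m)))
    where
    P : List (List ℤ)
    P = pairContainers (+ n) (+ t) (suc m)
    pair-count : count (+ 2 * + n - + t + 1ℤ) ℕ./ 2 ≡ suc m
    pair-count = trans (cong (λ z → count z ℕ./ 2) (difference (+ n′) (+ m))) (half-double (suc m))
      where
      difference : ∀ n′ m → + 2 * (n′ + ((1ℤ + m) + (1ℤ + m))) - (1ℤ + ((n′ + (1ℤ + m)) + (n′ + (1ℤ + m)))) + 1ℤ ≡ (1ℤ + m) + (1ℤ + m)
      difference = solve-∀
    recursive-n : ∀ n′ m → (1ℤ + ((n′ + (1ℤ + m)) + (n′ + (1ℤ + m)))) - (n′ + ((1ℤ + m) + (1ℤ + m))) - 1ℤ ≡ n′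
    recursive-n = solve-∀
    recursive-k : ∀ m e → (1ℤ + m + e) - (1ℤ + m) ≡ e
    recursive-k = solve-∀
    perm : concat (P ++ R) ↭ (interval (+ suc n′) (suc m) ++ interval (+ suc (n′ ℕ.+ suc m)) (suc m)) ++ concat R
    perm = ↭-trans (↭-reflexive (sym (LP.concat-++ P R)))
      (PermP.++⁺ʳ _ (pairContainers-concat (+ n) (+ t) (+ suc n′) (+ suc (n′ ℕ.+ suc m)) (suc m)
                                           (low-start (+ n′) (+ m)) (high-start (+ n′) (+ m))))
      where
      low-start : ∀ n′ m → (1ℤ + ((n′ + (1ℤ + m)) + (n′ + (1ℤ + m)))) - (n′ + ((1ℤ + m) + (1ℤ + m))) ≡ 1ℤ + n′
      low-start = solve-∀
      high-start : ∀ n′ m → (1ℤ + (n′ + (1ℤ + m))) + (1ℤ + m) ≡ n′ + ((1ℤ + m) + (1ℤ + m)) + 1ℤ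
      high-start = solve-∀

  -- Case t odd and t = n = 2q - 1 (k = q): the q pairs {j, n-j}, j < q, alone
  -- solve the task; the pair {0, n} brings in the element 0.
  odd-base : ∀ {f n k t r m} → 0 ℕ.< f → 2 ℕ.≤ k → + t ≤ + 2 * + n - 1ℤ → t % 2 ≡ suc r →
    n ≡ suc (m ℕ.+ m) → t ≡ suc (m ℕ.+ m) → k ≡ suc m → Solvable (suc f) n k t
  odd-base {f = suc _} {n = n} {t = t} {m = m} _ k≥2 narrow odd refl refl refl =
    P ++ [] ,
    piSolve-odd (no-base-case k≥2) narrow odd pair-count (recursive-n (+ m)) (ℤP.+-inverseʳ (+ suc m)) refl ,
    solution (trans (LP.length-++ P) (trans (ℕP.+-identityʳ _) (pairContainers-length (+ n) (+ t) (suc m))))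
             (AllP.++⁺ (pairContainers-sum (+ n) (+ t) (suc m)) [])
             (inj₂ perm)
    where
    P : List (List ℤ)
    P = pairContainers (+ n) (+ t) (suc m)
    pair-count : count (+ 2 * + n - + t + 1ℤ) ℕ./ 2 ≡ suc m
    pair-count = trans (cong (λ z → count z ℕ./ 2) (difference (+ m))) (half-double (suc m))
      where
      difference : ∀ m → + 2 * (1ℤ + (m + m)) - (1ℤ + (m + m)) + 1ℤ ≡ (1ℤ + m) + (1ℤ + m)
      difference = solve-∀
    recursive-n : ∀ m → (1ℤ + (m + m)) - (1ℤ + (m + m)) - 1ℤ ≡ -1ℤ
    recursive-n = solve-∀
    perm : concat (P ++ []) ↭ 0ℤ ∷ interval 1ℤ n
    perm = ↭-trans (↭-reflexive (cong concat (LP.++-identityʳ P)))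
      (↭-trans (pairContainers-concat (+ n) (+ t) 0ℤ (+ suc m) (suc m) (ℤP.+-inverseʳ (+ n)) (high-start (+ m)))
               (↭-reflexive (trans (interval-++ 0ℤ (+ suc m) (suc m) (suc m) refl) (cong (λ x → 0ℤ ∷ interval 1ℤ x) (ℕP.+-suc m m)))))
      where
      high-start : ∀ m → (1ℤ + m) + (1ℤ + m) ≡ 1ℤ + (m + m) + 1ℤ
      high-start = solve-∀

  one-case : ∀ {f n t} → Admissible n 1 t → Solvable (suc f) n 1 t
  one-case {n = n} {t = t} (admissible _ _ balanced) =
    range1 (+ n) ∷ [] , refl ,
    solution refl (trans (sum-range1 n) (cong +_ (sym t≡triangle)) ∷ [])
             (inj₁ (↭-reflexive (trans (LP.++-identityʳ _) (range1≡interval n))))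
    where
    t≡triangle : t ≡ triangle n
    t≡triangle = ℕP.*-cancelˡ-≡ t (triangle n) 2 (trans balanced (sym (2*triangle n)))

  -- Every recursive call is on a smaller n, so fuel f > n suffices.
  smaller : ∀ {f n n′ d} → n ℕ.< suc f → n ≡ n′ ℕ.+ d → 0 ℕ.< d → n′ ℕ.< f
  smaller n<1+f refl d>0 = ℕP.<-≤-trans (ℕP.m<m+n _ d>0) (ℕ.s≤s⁻¹ n<1+f)

  solve : ∀ f {n k t} → n ℕ.< f → Admissible n k t → Solvable f n k t
  solve zero    ()
  solve (suc f) {zero}   {zero}         _ _                      = [] , refl , solution refl [] (inj₁ ↭-refl)
  solve (suc f) {suc n₀} {zero}         _ (admissible _ _ ())
  solve (suc f) {n}      {suc zero}     _ adm                    = one-case {f} adm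
  solve (suc f) {zero}   {suc (suc k₂)} {zero}   _ (admissible () _ _)
  solve (suc f) {zero}   {suc (suc k₂)} {suc t₁} _ (admissible _ _ ())
  solve (suc f) {suc n₀} {suc (suc k₂)} {t} bound adm = case + t ≤? + 2 * + suc n₀ - 1ℤ of λ where
    (no wide) →
      let n′ , t′ , n≡ , t≡ , adm′ = wide-params (s≤s z≤n) adm (wide⇒≥ wide)
      in wide-case (s≤s (s≤s z≤n)) wide n≡ t≡ (solve f (smaller bound n≡ (s≤s z≤n)) adm′)
    (yes narrow) → case even-or-odd t of λ where
      (inj₁ even) →
        let n′ , q , e , n≡ , s≡ , k≡ , adm′ = even-params {s = t ℕ./ 2} adm (half-even t even) (narrow⇒< narrow)
        in even-case {s = t ℕ./ 2} {q = q} {e = e} (s≤s (s≤s z≤n)) narrow even (half-even t even) n≡ s≡ k≡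
                     (solve f (smaller bound n≡ (s≤s z≤n)) adm′)
      (inj₂ (r , odd)) → case odd-params {s = t ℕ./ 2} adm (half-odd t r odd) (narrow⇒< narrow) of λ where
        (inj₁ (m , n≡ , t≡ , k≡)) →
          odd-base (ℕP.<-≤-trans (s≤s z≤n) (ℕ.s≤s⁻¹ bound)) (s≤s (s≤s z≤n)) narrow odd n≡ t≡ k≡
        (inj₂ (n′ , m , e , n≡ , t≡ , k≡ , adm′)) →
          odd-case (s≤s (s≤s z≤n)) narrow odd n≡ t≡ k≡ (solve f (smaller bound n≡ (s≤s z≤n)) adm′)

open import Data.Nat using (ℕ; suc; _*_; _≥_; _/_)
open import Data.Nat.Properties using (n<1+n)
open import Data.Integer using (+_; 0ℤ; _≤_; _≟_)
open import Data.List using (length; concatMap; filter)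
open import Data.List.Relation.Unary.All using (All)
open import Data.List.Relation.Unary.Unique.Propositional using (Unique)
open import Data.List.Relation.Binary.Permutation.Propositional using (_↭_)
open import Data.Maybe using (just)
open import Data.Product using (∃-syntax; _×_; _,_)
open import Relation.Nullary.Decidable using (¬?)
open import Relation.Binary.PropositionalEquality using (_≡_)
open Arithmetic using (admissible; balanced-from-halved)
open Containers using (solution-spec)
open Correctness using (solve)

mainTheorem1 : (n k t : ℕ) → n ≥ 1 → k ≥ 1 → t ≥ 1 → t ≥ n → k * t ≡ (n * suc n) / 2 →
    ∃[ fuel ] ∃[ Ts ] (piSolve fuel (+ n) (+ k) (+ t) ≡ just Ts
    × length Ts ≡ k
    × All (λ T → All (λ x → 0ℤ ≤ x × x ≤ + n) T × Unique T × sumℤ T ≡ + t) Ts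
    × concatMap (filter (λ x → ¬? (x ≟ 0ℤ))) Ts ↭ range1 (+ n))
mainTheorem1 n k t _ _ t≥1 t≥n kt≡ =
  let Ts , run , sol = solve (suc n) (n<1+n n) (admissible t≥1 t≥n (balanced-from-halved n k t kt≡))
      size , containers , union = solution-spec sol
  in suc n , Ts , run , size , containers , union
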